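{- Let $p$ be an even positive integer, let $\mu=\frac{p^2}{4}+2p+2$, $\gamma=2\mu-\left(\frac{p}{2}+4\right)$, and let $S(p)=\langle \mu,\gamma,\gamma+1\rangle_{p\mu}$. Then the Eliahou number of $S(p)$ is $$\mathrm{E}(S(p))=\frac{p}{4}\left(1-\frac{p}{2}\right).$$
   Context: A numerical semigroup $S$ is a submonoid of $(\mathbb N,+)$ with finite complement in $\mathbb N$. For integers $a_1,\dots,a_r$ and $t$, $\langle a_1,\dots,a_r\rangle_t$ denotes the smallest numerical semigroup containing $a_1,\dots,a_r$ and all integers $\ge t$. For a numerical semigroup $S$: the conductor $c=c(S)$ is the smallest integer such that all integers $\ge c$ lie in $S$; the multiplicity $m=m(S)$ is the least positive element of $S$; $L=L(S)=\{s\in S: s<c\}$ is the set of left elements; $P=P(S)$ is the set of minimal generators (primitive elements) of $S$; $q=q(S)=\lceil c/m\rceil$; $\rho=\rho(S)=qm-c$; $I_q=\{z\in\mathbb Z: c\le z<c+m\}$; $D_q=I_q\setminus P$ (the decomposable elements of $S$ in $I_q$). The Eliahou number of $S$ is $\mathrm{E}(S)=|P\cap L|\,|L|-q\,|D_q|+\rho$. -}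

module Defs where

open import Data.Bool using (Bool; true; false; _∧_; _∨_; not; if_then_else_)
open import Data.Nat using (ℕ; zero; suc; _+_; _*_; _∸_; _≤ᵇ_; _<ᵇ_; _≡ᵇ_)
open import Data.Nat.DivMod using (_/_)
open import Data.List using (List; []; _∷_; map; filter; length; upTo)
open import Data.Bool.ListAction using (any; all)
open import Data.Integer as ℤ using (ℤ; +_)
open import Relation.Nullary.Decidable using (Dec)
open import Data.Bool.Properties using (T?)

range : ℕ → ℕ → List ℕ
range a b = map (λ i → a + i) (upTo (b ∸ a))

first : (ℕ → Bool) → List ℕ → ℕ → ℕ
first P []       d = d
first P (x ∷ xs) d = if P x then x else first P xs d

combo : List ℕ → ℕ → Bool
combo []       n = n ≡ᵇ 0
combo (g ∷ gs) n = any (λ k → combo gs (n ∸ k * g))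
                       (filter (λ k → T? (k * g ≤ᵇ n)) (upTo (suc n)))

-- Membership in ⟨ gens ⟩_t: the smallest submonoid of ℕ containing the
-- generators and all integers ≥ t, i.e. the combinations of the
-- generators together with all integers ≥ t.
inS : List ℕ → ℕ → ℕ → Bool
inS gens t n = (t ≤ᵇ n) ∨ combo gens n

module Semigroup (gens : List ℕ) (t : ℕ) where

  mem : ℕ → Bool
  mem = inS gens t

  -- conductor: least c such that every integer ≥ c lies in S
  -- (every integer ≥ t lies in S, so c ≤ t and it suffices to test [c,t))
  conductor : ℕ
  conductor = first (λ c → all mem (range c t)) (upTo (suc t)) t

  -- multiplicity: least positive element of S (it is ≤ max 1 t)
  multiplicity : ℕ
  multiplicity = first mem (range 1 (suc t)) (suc t)

  L : List ℕ
  L = filter (λ s → T? (mem s)) (upTo conductor)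

  isPrimitive : ℕ → Bool
  isPrimitive s = mem s ∧ (0 <ᵇ s)
                ∧ not (any (λ a → mem a ∧ mem (s ∸ a)) (range 1 s))

  PL : List ℕ
  PL = filter (λ s → T? (isPrimitive s)) L

  -- ceiling division ⌈ a / b ⌉ (b = 0 never occurs for a numerical semigroup)
  ceilDiv : ℕ → ℕ → ℕ
  ceilDiv a zero    = 0
  ceilDiv a (suc k) = (a + k) / suc k

  q : ℕ
  q = ceilDiv conductor multiplicity

  ρ : ℕ
  ρ = q * multiplicity ∸ conductor

  Iq : List ℕ
  Iq = range conductor (conductor + multiplicity)

  Dq : List ℕ
  Dq = filter (λ z → T? (not (isPrimitive z))) Iq

  eliahou : ℤ
  eliahou = (+ (length PL * length L)) ℤ.- (+ (q * length Dq)) ℤ.+ (+ ρ)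

-- μ = p²/4 + 2p + 2   (for p even, p²/4 = (p/2)²)
μ : ℕ → ℕ
μ p = (p / 2) * (p / 2) + 2 * p + 2

γ : ℕ → ℕ
γ p = 2 * μ p ∸ (p / 2 + 4)

E-S : ℕ → ℤ
E-S p = Semigroup.eliahou (μ p ∷ γ p ∷ suc (γ p) ∷ []) (p * μ p)

module Submission where

-- Write p = 2k, μ = k² + 4k + 2 and γ = 2μ − (k + 4).  Modulo μ the generators γ and γ + 1 are
-- −(k + 4) and −(k + 3), so aμ + bγ + c(γ + 1) = (a + 2B)μ − (B(k + 4) − c) with B = b + c, and
-- B ≤ k + 1 as long as the element is at most (2k + 1)μ.  Hence for n ≤ 2k the integer nμ − x
-- (0 ≤ x < μ) lies in S(p) iff x ∈ [b(k + 3), b(k + 3) + b] for some b ≤ n/2; in particular pμ − 1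
-- is a gap and pμ is the conductor.  In the next block, n = 2k + 1, the deficits 1, …, k + 2
-- (B = k + 1) are added.  Counting these stairs block by block gives |L| and |D_q|, while μ, γ, γ + 1
-- are the only primitive elements below pμ, q = 2k and ρ = 0; the value of E(S(p)) is then a
-- polynomial identity.

open import Data.Nat using (ℕ)

module Segments where
  open import Data.Bool using (Bool; true; false; _∧_; _∨_; if_then_else_; T)
  open import Data.Bool.Properties using (T?; T-∧; T-∨)
  open import Data.Empty using (⊥-elim)
  open import Data.List using (List; []; _∷_; filter; length; upTo; applyUpTo)
  open import Data.List.Properties using (map-upTo)
  open import Data.List.Membership.Propositional using (_∈_)
  open import Data.List.Relation.Unary.Any using (here; there)
  open import Data.Nat
  open import Data.Nat.Properties
  open import Data.Nat.Tactic.RingSolver using (solve-∀)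
  open import Data.Product using (∃-syntax; _×_; _,_; proj₁; proj₂)
  open import Data.Sum using (inj₁; inj₂)
  open import Function using (_∘_; _⇔_; mk⇔; Equivalence)
  open import Relation.Nullary using (¬_; contradiction)
  open import Relation.Binary.PropositionalEquality
  open import Defs using (range; first)
  open Equivalence using (to; from)

  segment : ℕ → ℕ → List ℕ
  segment a zero    = []
  segment a (suc n) = a ∷ segment (suc a) n

  applyUpTo≡segment : ∀ {f : ℕ → ℕ} a n → (∀ i → f i ≡ a + i) → applyUpTo f n ≡ segment a n
  applyUpTo≡segment a zero    f≗ = refl
  applyUpTo≡segment a (suc n) f≗ =
    cong₂ _∷_ (trans (f≗ 0) (+-identityʳ a))
              (applyUpTo≡segment (suc a) n (λ i → trans (f≗ (suc i)) (+-suc a i)))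

  upTo≡segment : ∀ n → upTo n ≡ segment 0 n
  upTo≡segment n = applyUpTo≡segment 0 n (λ _ → refl)

  range≡segment : ∀ a b → range a b ≡ segment a (b ∸ a)
  range≡segment a b = trans (map-upTo (a +_) (b ∸ a)) (applyUpTo≡segment a (b ∸ a) (λ _ → refl))

  ∈-segment : ∀ {x} a n → x ∈ segment a n ⇔ (a ≤ x × x < a + n)
  ∈-segment {x} a n = mk⇔ (member a n) (nonmember a n)
    where
    member : ∀ a n → x ∈ segment a n → a ≤ x × x < a + n
    member a (suc n) (here refl) = ≤-refl , m<m+n a z<s
    member a (suc n) (there x∈) =
      let (a<x , x<) = member (suc a) n x∈ in <⇒≤ a<x , ≤-trans x< (≤-reflexive (sym (+-suc a n)))
    nonmember : ∀ a n → a ≤ x × x < a + n → x ∈ segment a n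
    nonmember a zero    (a≤x , x<a+0) = contradiction a≤x (<⇒≱ (subst (x <_) (+-identityʳ a) x<a+0))
    nonmember a (suc n) (a≤x , x<) with m≤n⇒m<n∨m≡n a≤x
    ... | inj₂ refl = here refl
    ... | inj₁ a<x  = there (nonmember (suc a) n (a<x , ≤-trans x< (≤-reflexive (+-suc a n))))

  first-segment : ∀ {P} a n x d → a ≤ x → x < a + n → (∀ y → a ≤ y → y < x → ¬ T (P y)) → T (P x) →
                  first P (segment a n) d ≡ x
  first-segment     a zero    x d a≤x x<a+0 _ _ = contradiction a≤x (<⇒≱ (subst (x <_) (+-identityʳ a) x<a+0))
  first-segment {P} a (suc n) x d a≤x x< before px with P a in pa | m≤n⇒m<n∨m≡n a≤x
  ... | true  | inj₂ a≡x = a≡x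
  ... | true  | inj₁ a<x = contradiction (subst T (sym pa) _) (before a ≤-refl a<x)
  ... | false | inj₂ refl = contradiction px (subst (¬_ ∘ T) (sym pa) λ ())
  ... | false | inj₁ a<x =
    first-segment (suc a) n x d a<x (≤-trans x< (≤-reflexive (+-suc a n))) (λ y a<y → before y (<⇒≤ a<y)) px

  count : (ℕ → Bool) → ℕ → ℕ → ℕ
  count P a zero    = 0
  count P a (suc n) = if P a then suc (count P (suc a) n) else count P (suc a) n

  OnSegment : (ℕ → Set) → ℕ → ℕ → Set
  OnSegment R a n = ∀ x → a ≤ x → x < a + n → R x

  onSegment-head : ∀ {R a n} → OnSegment R a (suc n) → R a
  onSegment-head {a = a} h = h a ≤-refl (m<m+n a z<s)

  onSegment-tail : ∀ {R a n} → OnSegment R a (suc n) → OnSegment R (suc a) n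
  onSegment-tail {a = a} {n} h x a<x x<a+n = h x (<⇒≤ a<x) (≤-trans x<a+n (≤-reflexive (sym (+-suc a n))))

  length-filter-segment : ∀ P a n → length (filter (λ x → T? (P x)) (segment a n)) ≡ count P a n
  length-filter-segment P a zero    = refl
  length-filter-segment P a (suc n) with P a
  ... | true  = cong suc (length-filter-segment P (suc a) n)
  ... | false = length-filter-segment P (suc a) n

  count-++ : ∀ P a m n → count P a (m + n) ≡ count P a m + count P (a + m) n
  count-++ P a zero    n = cong (λ b → count P b n) (sym (+-identityʳ a))
  count-++ P a (suc m) n with P a
  ... | true  = cong suc (trans (count-++ P (suc a) m n) (cong (λ b → count P (suc a) m + count P b n) (sym (+-suc a m))))
  ... | false = trans (count-++ P (suc a) m n) (cong (λ b → count P (suc a) m + count P b n) (sym (+-suc a m)))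

  count-cong : ∀ {P Q} a n → OnSegment (λ x → T (P x) ⇔ T (Q x)) a n → count P a n ≡ count Q a n
  count-cong         a zero    _ = refl
  count-cong {P} {Q} a (suc n) h with P a | Q a | onSegment-head h
  ... | true  | true  | _ = cong suc (count-cong (suc a) n (onSegment-tail h))
  ... | false | false | _ = count-cong (suc a) n (onSegment-tail h)
  ... | true  | false | e = ⊥-elim (to e _)
  ... | false | true  | e = ⊥-elim (from e _)

  count-all : ∀ {P} a n → OnSegment (T ∘ P) a n → count P a n ≡ n
  count-all     a zero    _ = refl
  count-all {P} a (suc n) h with P a | onSegment-head h
  ... | true | _ = cong suc (count-all (suc a) n (onSegment-tail h))

  count-none : ∀ {P} a n → OnSegment (¬_ ∘ T ∘ P) a n → count P a n ≡ 0
  count-none     a zero    _ = refl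
  count-none {P} a (suc n) h with P a | onSegment-head h
  ... | false | _  = count-none (suc a) n (onSegment-tail h)
  ... | true  | ¬p = contradiction _ ¬p

  count-∨ : ∀ {P Q} → (∀ x → T (P x) → ¬ T (Q x)) → ∀ a n →
            count (λ x → P x ∨ Q x) a n ≡ count P a n + count Q a n
  count-∨         disj a zero    = refl
  count-∨ {P} {Q} disj a (suc n) with P a | Q a | disj a
  ... | true  | true  | d = contradiction _ (d _)
  ... | true  | false | _ = cong suc (count-∨ disj (suc a) n)
  ... | false | true  | _ = trans (cong suc (count-∨ disj (suc a) n)) (sym (+-suc _ _))
  ... | false | false | _ = count-∨ disj (suc a) n

  count-point : ∀ P Q x y → (T (P x) ⇔ T (Q y)) → count P x 1 ≡ count Q y 1
  count-point P Q x y e with P x | Q y | e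
  ... | true  | true  | _ = refl
  ... | false | false | _ = refl
  ... | true  | false | e = ⊥-elim (to e _)
  ... | false | true  | e = ⊥-elim (from e _)

  count-reflect : ∀ {P Q} a b n → (∀ i j → suc (i + j) ≡ n → T (P (a + i)) ⇔ T (Q (b + j))) →
                  count P a n ≡ count Q b n
  count-reflect         a b zero    h = refl
  count-reflect {P} {Q} a b (suc n) h = begin
    count P a (1 + n)                          ≡⟨ count-++ P a 1 n ⟩
    count P a 1 + count P (a + 1) n            ≡⟨ cong₂ _+_ first-to-last rest ⟩
    count Q (b + n) 1 + count Q b n            ≡⟨ +-comm _ (count Q b n) ⟩
    count Q b n + count Q (b + n) 1            ≡⟨ count-++ Q b n 1 ⟨
    count Q b (n + 1)                          ≡⟨ cong (count Q b) (+-comm n 1) ⟩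
    count Q b (suc n)                          ∎
    where
    open ≡-Reasoning
    first-to-last : count P a 1 ≡ count Q (b + n) 1
    first-to-last = count-point P Q a (b + n) (subst (λ z → T (P z) ⇔ T (Q (b + n))) (+-identityʳ a) (h 0 n refl))
    rest : count P (a + 1) n ≡ count Q b n
    rest = count-reflect (a + 1) b n λ i j e →
      subst (λ z → T (P z) ⇔ T (Q (b + j))) (sym (+-assoc a 1 i)) (h (suc i) j (cong suc e))

  count-step : ∀ P a n → (T (P a) ⇔ T (P (a + n))) → count P a n ≡ count P (suc a) n
  count-step P a n ends = +-cancelʳ-≡ (count P (a + n) 1) (count P a n) (count P (suc a) n) (begin
    count P a n + count P (a + n) 1       ≡⟨ count-++ P a n 1 ⟨
    count P a (n + 1)                     ≡⟨ cong (count P a) (+-comm n 1) ⟩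
    count P a (1 + n)                     ≡⟨ count-++ P a 1 n ⟩
    count P a 1 + count P (a + 1) n       ≡⟨ cong₂ _+_ (count-point P P a (a + n) ends) (cong (λ b → count P b n) (+-comm a 1)) ⟩
    count P (a + n) 1 + count P (suc a) n ≡⟨ +-comm (count P (a + n) 1) _ ⟩
    count P (suc a) n + count P (a + n) 1 ∎)
    where open ≡-Reasoning

  within : ℕ → ℕ → ℕ → Bool
  within lo hi x = (lo ≤ᵇ x) ∧ (x <ᵇ hi)

  T-within : ∀ lo hi {x} → T (within lo hi x) ⇔ (lo ≤ x × x < hi)
  T-within lo hi {x} = mk⇔
    (λ w → let (p , q) = to T-∧ w in ≤ᵇ⇒≤ lo x p , <ᵇ⇒< x hi q)
    (λ (p , q) → from T-∧ (≤⇒≤ᵇ p , <⇒<ᵇ q))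

  count-within : ∀ a n lo m → a ≤ lo → lo + m ≤ a + n → count (within lo (lo + m)) a n ≡ m
  count-within a n lo m a≤lo lo+m≤a+n = begin
    count W a n                                         ≡⟨ cong (count W a) n-split ⟩
    count W a (d + (m + r))                             ≡⟨ count-++ W a d (m + r) ⟩
    count W a d + count W (a + d) (m + r)               ≡⟨ cong (λ z → count W a d + count W z (m + r)) a+d≡lo ⟩
    count W a d + count W lo (m + r)                    ≡⟨ cong (count W a d +_) (count-++ W lo m r) ⟩
    count W a d + (count W lo m + count W (lo + m) r)   ≡⟨ cong₂ (λ u v → u + (count W lo m + v)) below above ⟩
    0 + (count W lo m + 0)                              ≡⟨ +-identityʳ (count W lo m) ⟩
    count W lo m                                        ≡⟨ count-all lo m (λ x lo≤x x<lo+m → from (T-within lo _) (lo≤x , x<lo+m)) ⟩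
    m                                                   ∎
    where
    open ≡-Reasoning
    W = within lo (lo + m)
    d = lo ∸ a
    r = a + n ∸ (lo + m)
    a+d≡lo : a + d ≡ lo
    a+d≡lo = m+[n∸m]≡n a≤lo
    n-split : n ≡ d + (m + r)
    n-split = +-cancelˡ-≡ a n (d + (m + r)) (begin
      a + n            ≡⟨ m+[n∸m]≡n lo+m≤a+n ⟨
      lo + m + r       ≡⟨ cong (λ z → z + m + r) a+d≡lo ⟨
      a + d + m + r    ≡⟨ trans (+-assoc (a + d) m r) (+-assoc a d (m + r)) ⟩
      a + (d + (m + r)) ∎)
    below : count W a d ≡ 0
    below = count-none a d (λ x _ x<a+d w → <⇒≱ (subst (x <_) a+d≡lo x<a+d) (proj₁ (to (T-within lo (lo + m)) w)))
    above : count W (lo + m) r ≡ 0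
    above = count-none (lo + m) r (λ x lo+m≤x _ w → <⇒≱ (proj₂ (to (T-within lo (lo + m)) w)) lo+m≤x)

  stair : ℕ → ℕ → ℕ → Bool
  stair w b = within (b * w) (b * w + suc b)

  stairs : ℕ → ℕ → ℕ → Bool
  stairs w zero    x = stair w 0 x
  stairs w (suc B) x = stairs w B x ∨ stair w (suc B) x

  stairsSize : ℕ → ℕ
  stairsSize zero    = 1
  stairsSize (suc B) = stairsSize B + suc (suc B)

  OnStairs : ℕ → ℕ → ℕ → Set
  OnStairs w B x = ∃[ b ] b ≤ B × b * w ≤ x × x ≤ b * w + b

  T-stair : ∀ w b {x} → T (stair w b x) ⇔ (b * w ≤ x × x ≤ b * w + b)
  T-stair w b {x} = mk⇔
    (λ s → let (p , q) = to (T-within (b * w) (b * w + suc b)) s in p , s≤s⁻¹ (subst (x <_) (+-suc (b * w) b) q))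
    (λ (p , q) → from (T-within (b * w) (b * w + suc b)) (p , subst (x <_) (sym (+-suc (b * w) b)) (s≤s q)))

  T-stairs : ∀ w B {x} → T (stairs w B x) ⇔ OnStairs w B x
  T-stairs w zero = mk⇔ (λ s → 0 , z≤n , to (T-stair w 0) s)
                        (λ { (0 , _ , on) → from (T-stair w 0) on })
  T-stairs w (suc B) {x} = mk⇔ lower raise
    where
    lower : T (stairs w B x ∨ stair w (suc B) x) → OnStairs w (suc B) x
    lower s with to T-∨ s
    ... | inj₁ s′ = let (b , b≤B , on) = to (T-stairs w B) s′ in b , m≤n⇒m≤1+n b≤B , on
    ... | inj₂ s′ = suc B , ≤-refl , to (T-stair w (suc B)) s′
    raise : OnStairs w (suc B) x → T (stairs w B x ∨ stair w (suc B) x)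
    raise (b , b≤1+B , on) with m≤n⇒m<n∨m≡n b≤1+B
    ... | inj₁ b<1+B = from T-∨ (inj₁ (from (T-stairs w B) (b , s≤s⁻¹ b<1+B , on)))
    ... | inj₂ refl  = from T-∨ (inj₂ (from (T-stair w b) on))

  onStairs-bound : ∀ {w B x} → OnStairs w B x → x ≤ B * w + B
  onStairs-bound (b , b≤B , _ , x≤) = ≤-trans x≤ (+-mono-≤ (*-monoˡ-≤ _ b≤B) b≤B)

  count-stairs : ∀ w B X → B < w → B * w + B < X → count (stairs w B) 0 X ≡ stairsSize B
  count-stairs w zero    X _ 0<X = count-within 0 X 0 1 z≤n 0<X
  count-stairs w (suc B) X B<w bound = begin
    count (stairs w (suc B)) 0 X                                ≡⟨ count-∨ below-next-stair 0 X ⟩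
    count (stairs w B) 0 X + count (stair w (suc B)) 0 X        ≡⟨ cong₂ _+_ (count-stairs w B X (<-trans (n<1+n B) B<w) bound′)
                                                                       (count-within 0 X (suc B * w) (suc (suc B)) z≤n
                                                                         (≤-trans (≤-reflexive (+-suc _ (suc B))) bound)) ⟩
    stairsSize B + suc (suc B)                                  ∎
    where
    open ≡-Reasoning
    top<next : B * w + B < suc B * w
    top<next = subst (B * w + B <_) (+-comm (B * w) w) (+-monoʳ-< (B * w) (<-trans (n<1+n B) B<w))
    below-next-stair : ∀ x → T (stairs w B x) → ¬ T (stair w (suc B) x)
    below-next-stair x s s′ =
      <⇒≱ (≤-<-trans (onStairs-bound (to (T-stairs w B) s)) top<next) (proj₁ (to (T-stair w (suc B)) s′))
    bound′ : B * w + B < X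
    bound′ = <-trans top<next (≤-<-trans (m≤m+n (suc B * w) (suc B)) bound)

  stairsSize-closed : ∀ B → 2 * stairsSize B ≡ (B + 1) * (B + 2)
  stairsSize-closed zero    = refl
  stairsSize-closed (suc B) = begin
    2 * (stairsSize B + suc (suc B))     ≡⟨ *-distribˡ-+ 2 (stairsSize B) _ ⟩
    2 * stairsSize B + 2 * suc (suc B)   ≡⟨ cong (_+ 2 * suc (suc B)) (stairsSize-closed B) ⟩
    (B + 1) * (B + 2) + 2 * suc (suc B)  ≡⟨ identity B ⟩
    (suc B + 1) * (suc B + 2)            ∎
    where
    open ≡-Reasoning
    identity : ∀ B → (B + 1) * (B + 2) + 2 * suc (suc B) ≡ (suc B + 1) * (suc B + 2)
    identity = solve-∀

module NumericalSemigroups where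
  open import Data.Bool using (Bool; true; false; _∧_; not; T)
  open import Data.Bool.Properties using (T?; T-∧; T-∨)
  open import Data.Bool.ListAction using (any; all)
  open import Data.List using (List; []; _∷_; filter; length; upTo)
  open import Data.List.Membership.Propositional using (_∈_; find; lose)
  open import Data.List.Membership.Propositional.Properties using (∈-filter⁺; ∈-filter⁻; ∈-upTo⁺)
  open import Data.List.Relation.Unary.All using (All; []; _∷_; lookup)
  open import Data.List.Relation.Unary.All.Properties using (all⁺)
  open import Data.List.Relation.Unary.Any.Properties using (any⁺; any⁻)
  open import Data.Nat
  open import Data.Nat.Properties
  open import Data.Nat.DivMod using (_/_; +-distrib-/-∣ʳ; m<n⇒m/n≡0; m*n/n≡m; /-congˡ)
  open import Data.Nat.Divisibility using (n∣m*n)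
  open import Data.Nat.Tactic.RingSolver using (solve-∀)
  open import Data.Product using (∃-syntax; _×_; _,_)
  open import Data.Sum using (inj₁; inj₂; [_,_]′)
  open import Function using (_∘_; id; _⇔_; mk⇔; Equivalence)
  open import Relation.Nullary using (¬_; contradiction; yes; no)
  open import Relation.Binary.PropositionalEquality
  open import Defs using (range; first; combo; module Semigroup)
  open Equivalence using (to; from)
  open Segments

  quotient-of : ∀ {d} .{{_ : NonZero d}} r q → r < d → (r + q * d) / d ≡ q
  quotient-of {d} r q r<d = begin
    (r + q * d) / d      ≡⟨ +-distrib-/-∣ʳ r (n∣m*n q) ⟩
    r / d + q * d / d    ≡⟨ cong₂ _+_ (m<n⇒m/n≡0 r<d) (m*n/n≡m q d) ⟩
    q                    ∎
    where open ≡-Reasoning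

  quotient-unique : ∀ {d} .{{_ : NonZero d}} {q₁ q₂ r₁ r₂} → r₁ < d → r₂ < d →
                    r₁ + q₁ * d ≡ r₂ + q₂ * d → q₁ ≡ q₂ × r₁ ≡ r₂
  quotient-unique {q₁ = q₁} {q₂} {r₁} {r₂} r₁<d r₂<d eq =
    q₁≡q₂ , +-cancelʳ-≡ (q₁ * _) r₁ r₂ (trans eq (cong (λ q → r₂ + q * _) (sym q₁≡q₂)))
    where
    q₁≡q₂ : q₁ ≡ q₂
    q₁≡q₂ = trans (sym (quotient-of r₁ q₁ r₁<d)) (trans (/-congˡ eq) (quotient-of r₂ q₂ r₂<d))

  positive-complement : ∀ {g r s} → g + r ≡ s → s ≢ g → 0 < r
  positive-complement {r = zero}  g+0≡s s≢g = contradiction (trans (sym g+0≡s) (+-identityʳ _)) s≢g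
  positive-complement {r = suc _} _     _   = z<s

  IsCombination : List ℕ → ℕ → Set
  IsCombination []       n = n ≡ 0
  IsCombination (g ∷ gs) n = ∃[ c ] ∃[ r ] c * g + r ≡ n × IsCombination gs r

  combo-sound : ∀ gs n → T (combo gs n) → IsCombination gs n
  combo-sound []       n t = ≡ᵇ⇒≡ n 0 t
  combo-sound (g ∷ gs) n t
    with c , c∈ , t′ ← find (any⁻ (λ c → combo gs (n ∸ c * g)) _ t)
    with _ , cg≤n ← ∈-filter⁻ (λ c → T? (c * g ≤ᵇ n)) {xs = upTo (suc n)} c∈
    = c , n ∸ c * g , m+[n∸m]≡n (≤ᵇ⇒≤ (c * g) n cg≤n) , combo-sound gs (n ∸ c * g) t′

  combo-complete : ∀ gs n → All (1 ≤_) gs → IsCombination gs n → T (combo gs n)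
  combo-complete []       n _            n≡0              = ≡⇒≡ᵇ n 0 n≡0
  combo-complete (g ∷ gs) n (1≤g ∷ 1≤gs) (c , r , eq , r∈) =
    any⁺ _ (lose (∈-filter⁺ (λ c → T? (c * g ≤ᵇ n)) (∈-upTo⁺ (s≤s c≤n)) (≤⇒≤ᵇ cg≤n))
                 (subst (T ∘ combo gs) r≡ (combo-complete gs r 1≤gs r∈)))
    where
    cg≤n : c * g ≤ n
    cg≤n = ≤-trans (m≤m+n (c * g) r) (≤-reflexive eq)
    c≤n : c ≤ n
    c≤n = ≤-trans (≤-trans (≤-reflexive (sym (*-identityʳ c))) (*-monoʳ-≤ c 1≤g)) cg≤n
    r≡ : r ≡ n ∸ c * g
    r≡ = sym (trans (cong (_∸ c * g) (sym eq)) (m+n∸m≡n (c * g) r))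

  isCombination₃ : ∀ g₁ g₂ g₃ y →
                   IsCombination (g₁ ∷ g₂ ∷ g₃ ∷ []) y ⇔ (∃[ a ] ∃[ b ] ∃[ c ] a * g₁ + b * g₂ + c * g₃ ≡ y)
  isCombination₃ g₁ g₂ g₃ y = mk⇔
    (λ { (a , _ , refl , b , _ , refl , c , _ , refl , refl) → a , b , c , identity a b c g₁ g₂ g₃ })
    (λ (a , b , c , eq) → a , b * g₂ + c * g₃ , trans (sym (+-assoc (a * g₁) _ _)) eq ,
                          b , c * g₃ , refl , c , 0 , +-identityʳ _ , refl)
    where
    identity : ∀ a b c g₁ g₂ g₃ → a * g₁ + b * g₂ + c * g₃ ≡ a * g₁ + (b * g₂ + (c * g₃ + 0))
    identity = solve-∀

  filter-∧ : ∀ {A : Set} (P Q : A → Bool) xs →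
             filter (λ x → T? (Q x)) (filter (λ x → T? (P x)) xs) ≡ filter (λ x → T? (P x ∧ Q x)) xs
  filter-∧ P Q []       = refl
  filter-∧ P Q (x ∷ xs) with P x
  ... | false = filter-∧ P Q xs
  ... | true with Q x
  ...   | true  = cong (x ∷_) (filter-∧ P Q xs)
  ...   | false = filter-∧ P Q xs

  T-not : ∀ b → T (not b) ⇔ (¬ T b)
  T-not true  = mk⇔ (λ ()) (λ ¬t → ¬t _)
  T-not false = mk⇔ (λ _ ()) (λ _ → _)

  module _ (gens : List ℕ) (t : ℕ) where
    open Semigroup gens t

    mem-≥ : ∀ {y} → t ≤ y → T (mem y)
    mem-≥ t≤y = from T-∨ (inj₁ (≤⇒≤ᵇ t≤y))

    combo⇒mem : ∀ {y} → T (combo gens y) → T (mem y)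
    combo⇒mem c = from T-∨ (inj₂ c)

    mem-< : ∀ {y} → y < t → T (mem y) ⇔ T (combo gens y)
    mem-< {y} y<t = mk⇔ ([ (λ t≤y → contradiction (≤ᵇ⇒≤ t y t≤y) (<⇒≱ y<t)) , id ]′ ∘ to T-∨) combo⇒mem

    Decomposable : ℕ → Set
    Decomposable s = ∃[ a ] ∃[ r ] 0 < a × 0 < r × a + r ≡ s × T (mem a) × T (mem r)

    T-any-split : ∀ s → T (any (λ a → mem a ∧ mem (s ∸ a)) (range 1 s)) ⇔ Decomposable s
    T-any-split s = mk⇔ split join
      where
      below : ∀ {a} s → 1 ≤ a → a < 1 + (s ∸ 1) → a < s
      below zero    1≤a a<1 = contradiction 1≤a (<⇒≱ a<1)
      below (suc s) _   a<  = a<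
      split : T (any (λ a → mem a ∧ mem (s ∸ a)) (range 1 s)) → Decomposable s
      split d with a , a∈ , ma∧mr ← find (any⁻ _ (range 1 s) d) =
        let (1≤a , a<) = to (∈-segment 1 (s ∸ 1)) (subst (a ∈_) (range≡segment 1 s) a∈)
            a<s = below s 1≤a a<
            (ma , mr) = to T-∧ ma∧mr
        in a , s ∸ a , 1≤a , m<n⇒0<n∸m a<s , m+[n∸m]≡n (<⇒≤ a<s) , ma , mr
      join : Decomposable s → T (any (λ a → mem a ∧ mem (s ∸ a)) (range 1 s))
      join (a , r , 0<a , 0<r , a+r≡s , ma , mr) =
        any⁺ _ (lose (subst (a ∈_) (sym (range≡segment 1 s)) (from (∈-segment 1 (s ∸ 1)) (0<a , a<1+[s∸1])))
                     (from T-∧ (ma , subst (T ∘ mem) r≡s∸a mr)))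
        where
        a<s : a < s
        a<s = subst (a <_) a+r≡s (m<m+n a 0<r)
        a<1+[s∸1] : a < 1 + (s ∸ 1)
        a<1+[s∸1] = subst (a <_) (sym (m+[n∸m]≡n (≤-trans 0<a (<⇒≤ a<s)))) a<s
        r≡s∸a : r ≡ s ∸ a
        r≡s∸a = sym (trans (cong (_∸ a) (sym a+r≡s)) (m+n∸m≡n a r))

    T-isPrimitive : ∀ s → T (isPrimitive s) ⇔ (T (mem s) × 0 < s × ¬ Decomposable s)
    T-isPrimitive s = mk⇔
      (λ p → let (ms , rest) = to T-∧ p ; (pos , nd) = to T-∧ rest
             in ms , <ᵇ⇒< 0 s pos , λ d → to (T-not _) nd (from (T-any-split s) d))
      (λ (ms , 0<s , nd) → from T-∧ (ms , from T-∧ (<⇒<ᵇ 0<s , from (T-not _) (nd ∘ to (T-any-split s)))))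

    ¬isPrimitive⇒Decomposable : ∀ s → T (mem s) → 0 < s → ¬ T (isPrimitive s) → Decomposable s
    ¬isPrimitive⇒Decomposable s ms 0<s ¬prim with T? (any (λ a → mem a ∧ mem (s ∸ a)) (range 1 s))
    ... | yes split = to (T-any-split s) split
    ... | no ¬split = contradiction (from (T-isPrimitive s) (ms , 0<s , ¬split ∘ from (T-any-split s))) ¬prim

    conductor-≡ : .{{_ : NonZero t}} → ¬ T (mem (pred t)) → conductor ≡ t
    conductor-≡ gap =
      trans (cong (λ cs → first AllIn cs t) (upTo≡segment (suc t)))
            (first-segment 0 (suc t) t t z≤n (n<1+n t) gap-witnessed all-from-t)
      where
      AllIn : ℕ → Bool
      AllIn c = all mem (range c t)
      all-from-t : T (AllIn t)
      all-from-t = subst (T ∘ all mem) (sym (trans (range≡segment t t) (cong (segment t) (n∸n≡0 t)))) _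
      gap-witnessed : ∀ c → 0 ≤ c → c < t → ¬ T (AllIn c)
      gap-witnessed c _ c<t allIn = gap (lookup (all⁺ mem (range c t) allIn) pred-t∈)
        where
        pred-t∈ : pred t ∈ range c t
        pred-t∈ = subst (pred t ∈_) (sym (range≡segment c t)) (from (∈-segment c (t ∸ c))
                    (<⇒≤pred c<t , subst (pred t <_) (sym (m+[n∸m]≡n (<⇒≤ c<t))) (m≤pred[n]⇒suc[m]≤n ≤-refl)))

    multiplicity-≡ : ∀ m → 0 < m → m ≤ t → T (mem m) → (∀ y → 0 < y → y < m → ¬ T (mem y)) → multiplicity ≡ m
    multiplicity-≡ m 0<m m≤t mm below =
      trans (cong (λ ys → first mem ys (suc t)) (range≡segment 1 (suc t)))
            (first-segment 1 t m (suc t) 0<m (s≤s m≤t) below mm)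

    length-L : length L ≡ count mem 0 conductor
    length-L = trans (cong (length ∘ filter (λ s → T? (mem s))) (upTo≡segment conductor))
                     (length-filter-segment mem 0 conductor)

    length-PL : length PL ≡ count (λ s → mem s ∧ isPrimitive s) 0 conductor
    length-PL = trans (cong length (filter-∧ mem isPrimitive (upTo conductor)))
                      (trans (cong (length ∘ filter (λ s → T? (mem s ∧ isPrimitive s))) (upTo≡segment conductor))
                             (length-filter-segment _ 0 conductor))

    length-Dq : length Dq ≡ count (not ∘ isPrimitive) conductor multiplicity
    length-Dq = trans (cong (length ∘ filter (λ z → T? (not (isPrimitive z))))
                            (trans (range≡segment conductor (conductor + multiplicity))
                                   (cong (segment conductor) (m+n∸m≡n conductor multiplicity))))
                      (length-filter-segment _ conductor multiplicity)

    ceilDiv-* : ∀ n m → ceilDiv (n * suc m) (suc m) ≡ n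
    ceilDiv-* n m = trans (cong (_/ suc m) (+-comm (n * suc m) m)) (quotient-of m n (n<1+n m))

module EvenCase (j : ℕ) where
  open import Data.Bool using (Bool; _∧_; _∨_; not; T)
  open import Data.Bool.Properties using (T?; T-∧; T-∨)
  open import Data.List using (List; []; _∷_; length)
  open import Data.List.Relation.Unary.All using ([]; _∷_)
  open import Data.Nat
  open import Data.Nat.Properties
  open import Data.Nat.Tactic.RingSolver using (solve-∀)
  open import Data.Product using (∃-syntax; _×_; _,_; proj₁; proj₂)
  open import Data.Sum using (_⊎_; inj₁; inj₂)
  open import Function using (_∘_; case_of_; _⇔_; mk⇔; Equivalence)
  import Function.Properties.Equivalence as ⇔
  open import Relation.Nullary using (¬_; contradiction; yes; no)
  open import Relation.Nullary.Decidable using (decidable-stable)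
  open import Relation.Binary.PropositionalEquality
  open import Data.Nat.DivMod using (m*n/n≡m)
  open import Defs using (combo; module Semigroup; μ; γ; E-S)
  open Equivalence using (to; from)
  open Segments
  open NumericalSemigroups

  -- S(p) for p = 2k with k = j + 1: M = μ, G = γ, t = pμ, and w = k + 3 is the period of the stairs.
  k M G w t : ℕ
  k = suc j
  M = 2 + k * (k + 4)
  G = k * (2 * k + 7)
  w = k + 3
  t = k * 2 * M

  gens : List ℕ
  gens = M ∷ G ∷ suc G ∷ []

  C : ℕ → Bool
  C = combo gens

  module S = Semigroup gens t

  G+[k+4]≡2M : G + (k + 4) ≡ 2 * M
  G+[k+4]≡2M = identity k
    where
    identity : ∀ k → k * (2 * k + 7) + (k + 4) ≡ 2 * (2 + k * (k + 4))
    identity = solve-∀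

  [1+k][k+4]≡M+[k+2] : suc k * (k + 4) ≡ M + (k + 2)
  [1+k][k+4]≡M+[k+2] = identity k
    where
    identity : ∀ k → suc k * (k + 4) ≡ (2 + k * (k + 4)) + (k + 2)
    identity = solve-∀

  [k+1]G+[k+2]≡[2k+1]M : (k + 1) * G + (k + 2) ≡ suc (k * 2) * M
  [k+1]G+[k+2]≡[2k+1]M = identity k
    where
    identity : ∀ k → (k + 1) * (k * (2 * k + 7)) + (k + 2) ≡ suc (k * 2) * (2 + k * (k + 4))
    identity = solve-∀

  [2k+1]M<[k+2]G : suc (k * 2) * M < (k + 2) * G
  [2k+1]M<[k+2]G = subst (suc (k * 2) * M <_) (sym (identity j)) (m<m+n _ z<s)
    where
    identity : ∀ j → (suc j + 2) * (suc j * (2 * suc j + 7))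
                   ≡ suc (suc j * 2) * (2 + suc j * (suc j + 4)) + suc (2 * (j * j) + 10 * j + 5)
    identity = solve-∀

  M<G : M < G
  M<G = subst (M <_) (sym (identity j)) (m<m+n M z<s)
    where
    identity : ∀ j → suc j * (2 * suc j + 7) ≡ (2 + suc j * (suc j + 4)) + suc (j * j + 5 * j + 1)
    identity = solve-∀

  k+2<M : k + 2 < M
  k+2<M = subst (k + 2 <_) (sym (identity j)) (m<m+n (k + 2) z<s)
    where
    identity : ∀ j → 2 + suc j * (suc j + 4) ≡ (suc j + 2) + suc (j * j + 5 * j + 3)
    identity = solve-∀

  2M≤t : 2 * M ≤ t
  2M≤t = subst (2 * M ≤_) (sym (identity j M)) (m≤m+n (2 * M) _)
    where
    identity : ∀ j M → suc j * 2 * M ≡ 2 * M + j * 2 * M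
    identity = solve-∀

  stairs-below-M : ∀ {B} → B ≤ k → B * w + B < M
  stairs-below-M {B} B≤k = subst (_< M) (sym (identity B k)) (s≤s (≤-trans (*-monoˡ-≤ (k + 4) B≤k) (n≤1+n _)))
    where
    identity : ∀ B k → B * (k + 3) + B ≡ B * (k + 4)
    identity = solve-∀

  Combination : ℕ → Set
  Combination y = ∃[ a ] ∃[ b ] ∃[ c ] a * M + b * G + c * suc G ≡ y

  T-C : ∀ {y} → T (C y) ⇔ Combination y
  T-C {y} = mk⇔ (to (isCombination₃ M G (suc G) y) ∘ combo-sound gens y)
                (combo-complete gens y (s≤s z≤n ∷ ≤-trans (s≤s z≤n) (<⇒≤ M<G) ∷ s≤s z≤n ∷ [])
                 ∘ from (isCombination₃ M G (suc G) y))

  combination-+ : ∀ {y z} → Combination y → Combination z → Combination (y + z)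
  combination-+ (a , b , c , refl) (a′ , b′ , c′ , refl) = a + a′ , b + b′ , c + c′ , identity a b c a′ b′ c′ M G
    where
    identity : ∀ a b c a′ b′ c′ M G → (a + a′) * M + (b + b′) * G + (c + c′) * suc G
                                     ≡ (a * M + b * G + c * suc G) + (a′ * M + b′ * G + c′ * suc G)
    identity = solve-∀

  combination-M* : ∀ n → Combination (n * M)
  combination-M* n = n , 0 , 0 , trans (+-identityʳ _) (+-identityʳ _)

  combination-M : Combination M
  combination-M = subst Combination (*-identityˡ M) (combination-M* 1)

  combination-G : Combination G
  combination-G = 0 , 1 , 0 , trans (+-identityʳ _) (+-identityʳ G)

  combination-suc-G : Combination (suc G)
  combination-suc-G = 0 , 0 , 1 , +-identityʳ (suc G)

  combination-≥M : ∀ {y} → Combination y → 0 < y → M ≤ y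
  combination-≥M (zero  , zero  , zero  , refl) ()
  combination-≥M (suc a , b     , c     , refl) _ = ≤-trans (m≤m+n M (a * M)) (≤-trans (m≤m+n _ (b * G)) (m≤m+n _ _))
  combination-≥M (zero  , suc b , c     , refl) _ = ≤-trans (<⇒≤ M<G) (≤-trans (m≤m+n G (b * G)) (m≤m+n _ _))
  combination-≥M (zero  , zero  , suc c , refl) _ = ≤-trans (<⇒≤ M<G) (≤-trans (n≤1+n G) (m≤m+n (suc G) _))

  IsGenerator : ℕ → Set
  IsGenerator s = s ≡ M ⊎ s ≡ G ⊎ s ≡ suc G

  SumOfTwo : ℕ → Set
  SumOfTwo s = ∃[ g ] ∃[ r ] 0 < g × 0 < r × g + r ≡ s × Combination g × Combination r

  SumOfTwo⇒Combination : ∀ {s} → SumOfTwo s → Combination s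
  SumOfTwo⇒Combination (_ , _ , _ , _ , refl , cg , cr) = combination-+ cg cr

  SumOfTwo⇒2M≤ : ∀ {s} → SumOfTwo s → 2 * M ≤ s
  SumOfTwo⇒2M≤ (g , r , 0<g , 0<r , refl , cg , cr) =
    subst (_≤ g + r) (cong (M +_) (sym (+-identityʳ M))) (+-mono-≤ (combination-≥M cg 0<g) (combination-≥M cr 0<r))

  Combination⇒SumOfTwo : ∀ {s} → Combination s → 0 < s → ¬ IsGenerator s → SumOfTwo s
  Combination⇒SumOfTwo (zero  , zero  , zero  , refl) () _
  Combination⇒SumOfTwo (suc a , b , c , refl) _ ¬gen =
    M , a * M + b * G + c * suc G , z<s , positive-complement (identity a b c M G) (¬gen ∘ inj₁) , identity a b c M G ,
    combination-M , (a , b , c , refl)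
    where
    identity : ∀ a b c M G → M + (a * M + b * G + c * suc G) ≡ suc a * M + b * G + c * suc G
    identity = solve-∀
  Combination⇒SumOfTwo (zero  , suc b , c , refl) _ ¬gen =
    G , b * G + c * suc G , <-trans z<s M<G , positive-complement (sym (+-assoc G (b * G) _)) (¬gen ∘ inj₂ ∘ inj₁) ,
    sym (+-assoc G (b * G) _) , combination-G , (0 , b , c , refl)
  Combination⇒SumOfTwo (zero  , zero  , suc c , refl) _ ¬gen =
    suc G , c * suc G , z<s , positive-complement refl (¬gen ∘ inj₂ ∘ inj₂) , refl , combination-suc-G , (0 , 0 , c , refl)

  combination-shift : ∀ a b c → a * M + b * G + c * suc G + (b + c) * (k + 4) ≡ (a + 2 * (b + c)) * M + c
  combination-shift a b c = begin
    a * M + b * G + c * suc G + (b + c) * (k + 4) ≡⟨ regroup a b c M G (k + 4) ⟩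
    a * M + (b + c) * (G + (k + 4)) + c           ≡⟨ cong (λ z → a * M + (b + c) * z + c) G+[k+4]≡2M ⟩
    a * M + (b + c) * (2 * M) + c                 ≡⟨ collect a (b + c) c M ⟩
    (a + 2 * (b + c)) * M + c                     ∎
    where
    open ≡-Reasoning
    regroup : ∀ a b c M G K → a * M + b * G + c * suc G + (b + c) * K ≡ a * M + (b + c) * (G + K) + c
    regroup = solve-∀
    collect : ∀ a B c M → a * M + B * (2 * M) + c ≡ (a + 2 * B) * M + c
    collect = solve-∀

  generator-count-bound : ∀ a b c {x n} → a * M + b * G + c * suc G + x ≡ n * M → n ≤ suc (k * 2) → b + c ≤ suc k
  generator-count-bound a b c {x} {n} eq n≤ with b + c ≤? suc k
  ... | yes B≤ = B≤
  ... | no  B≰ = contradiction [2k+1]M<[k+2]G (≤⇒≯ (begin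
    (k + 2) * G                                  ≤⟨ *-monoˡ-≤ G (subst (_≤ b + c) (+-comm 2 k) (≰⇒> B≰)) ⟩
    (b + c) * G                                  ≤⟨ m≤m+n ((b + c) * G) (a * M + c + x) ⟩
    (b + c) * G + (a * M + c + x)                ≡⟨ regroup a b c x M G ⟨
    a * M + b * G + c * suc G + x                ≡⟨ eq ⟩
    n * M                                        ≤⟨ *-monoˡ-≤ M n≤ ⟩
    suc (k * 2) * M                              ∎))
    where
    open ≤-Reasoning
    regroup : ∀ a b c x M G → a * M + b * G + c * suc G + x ≡ (b + c) * G + (a * M + c + x)
    regroup = solve-∀

  low-deficit : ∀ {q B c x n} → c ≤ B → B ≤ k → q * M + c + x ≡ n * M + B * (k + 4) → x < M →
                q ≡ n × B * w ≤ x × x ≤ B * w + B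
  low-deficit {q} {B} {c} {x} {n} c≤B B≤k eq x<M = q≡n , Bw≤x , x≤Bw+B
    where
    d = B * (k + 4) ∸ c
    c+d≡B[k+4] : c + d ≡ B * (k + 4)
    c+d≡B[k+4] = m+[n∸m]≡n (≤-trans c≤B (m≤m*n B (k + 4)))
    Bw+B≡c+d : B * w + B ≡ c + d
    Bw+B≡c+d = trans (identity B k) (sym c+d≡B[k+4])
      where
      identity : ∀ B k → B * (k + 3) + B ≡ B * (k + 4)
      identity = solve-∀
    d<M : d < M
    d<M = ≤-<-trans (m≤n+m d c) (subst (_< M) Bw+B≡c+d (stairs-below-M B≤k))
    quotients : q ≡ n × x ≡ d
    quotients = quotient-unique x<M d<M (+-cancelˡ-≡ c _ _ (begin
      c + (x + q * M)     ≡⟨ rearrange c x (q * M) ⟩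
      q * M + c + x       ≡⟨ eq ⟩
      n * M + B * (k + 4) ≡⟨ cong (n * M +_) c+d≡B[k+4] ⟨
      n * M + (c + d)     ≡⟨ rearrange′ (n * M) c d ⟩
      c + (d + n * M)     ∎))
      where
      open ≡-Reasoning
      rearrange : ∀ c x y → c + (x + y) ≡ y + c + x
      rearrange = solve-∀
      rearrange′ : ∀ y c d → y + (c + d) ≡ c + (d + y)
      rearrange′ = solve-∀
    q≡n = proj₁ quotients
    x≡d = proj₂ quotients
    Bw≤x : B * w ≤ x
    Bw≤x = +-cancelʳ-≤ B (B * w) x (begin
      B * w + B ≡⟨ Bw+B≡c+d ⟩
      c + d     ≡⟨ cong (c +_) x≡d ⟨
      c + x     ≤⟨ +-monoˡ-≤ x c≤B ⟩
      B + x     ≡⟨ +-comm B x ⟩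
      x + B     ∎)
      where open ≤-Reasoning
    x≤Bw+B : x ≤ B * w + B
    x≤Bw+B = subst (_≤ B * w + B) (sym x≡d) (subst (d ≤_) (sym Bw+B≡c+d) (m≤n+m d c))

  top-deficit : ∀ {q c x n} → c ≤ suc k → q * M + c + x ≡ n * M + suc k * (k + 4) → x < M →
                q ≡ suc n × 1 ≤ x × x ≤ k + 2
  top-deficit {q} {c} {x} {n} c≤1+k eq x<M = q≡1+n , subst (1 ≤_) (sym x≡e) 0<e , subst (_≤ k + 2) (sym x≡e) e≤k+2
    where
    e = k + 2 ∸ c
    c+e≡k+2 : c + e ≡ k + 2
    c+e≡k+2 = m+[n∸m]≡n (≤-trans c≤1+k (≤-trans (n≤1+n (suc k)) (≤-reflexive (+-comm 2 k))))
    e≤k+2 : e ≤ k + 2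
    e≤k+2 = subst (e ≤_) c+e≡k+2 (m≤n+m e c)
    0<e : 0 < e
    0<e = positive-complement c+e≡k+2 (λ k+2≡c → <⇒≱ (s≤s c≤1+k) (≤-reflexive (trans (+-comm 2 k) k+2≡c)))
    quotients : q ≡ suc n × x ≡ e
    quotients = quotient-unique x<M (≤-<-trans e≤k+2 k+2<M) (+-cancelˡ-≡ c _ _ (begin
      c + (x + q * M)            ≡⟨ rearrange c x (q * M) ⟩
      q * M + c + x              ≡⟨ eq ⟩
      n * M + suc k * (k + 4)    ≡⟨ cong (n * M +_) [1+k][k+4]≡M+[k+2] ⟩
      n * M + (M + (k + 2))      ≡⟨ cong (λ z → n * M + (M + z)) c+e≡k+2 ⟨
      n * M + (M + (c + e))      ≡⟨ rearrange′ (n * M) M c e ⟩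
      c + (e + suc n * M)        ∎))
      where
      open ≡-Reasoning
      rearrange : ∀ c x y → c + (x + y) ≡ y + c + x
      rearrange = solve-∀
      rearrange′ : ∀ y M c e → y + (M + (c + e)) ≡ c + (e + (M + y))
      rearrange′ = solve-∀
    q≡1+n = proj₁ quotients
    x≡e = proj₂ quotients

  deficit-equation : ∀ a b c {x n} → a * M + b * G + c * suc G + x ≡ n * M →
                     (a + 2 * (b + c)) * M + c + x ≡ n * M + (b + c) * (k + 4)
  deficit-equation a b c {x} {n} eq = begin
    (a + 2 * (b + c)) * M + c + x                 ≡⟨ cong (_+ x) (combination-shift a b c) ⟨
    a * M + b * G + c * suc G + (b + c) * (k + 4) + x ≡⟨ swap (a * M + b * G + c * suc G) _ x ⟩
    a * M + b * G + c * suc G + x + (b + c) * (k + 4) ≡⟨ cong (_+ (b + c) * (k + 4)) eq ⟩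
    n * M + (b + c) * (k + 4)                     ∎
    where
    open ≡-Reasoning
    swap : ∀ y z x → y + z + x ≡ y + x + z
    swap = solve-∀

  combination-deficit : ∀ {y x n} → Combination y → y + x ≡ n * M → x < M → n ≤ suc (k * 2) →
    (∃[ b ] 2 * b ≤ n × b * w ≤ x × x ≤ b * w + b) ⊎ (n ≡ suc (k * 2) × 1 ≤ x × x ≤ k + 2)
  combination-deficit {x = x} {n} (a , b , c , refl) y+x≡nM x<M n≤2k+1
    with m≤n⇒m<n∨m≡n (generator-count-bound a b c y+x≡nM n≤2k+1)
  ... | inj₁ B<1+k =
    let (q≡n , lo , hi) = low-deficit (m≤n+m c b) (s≤s⁻¹ B<1+k) (deficit-equation a b c {x} {n} y+x≡nM) x<M
    in inj₁ (b + c , subst (2 * (b + c) ≤_) q≡n (m≤n+m _ a) , lo , hi)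
  ... | inj₂ B≡1+k =
    let (q≡1+n , lo , hi) = top-deficit (subst (c ≤_) B≡1+k (m≤n+m c b))
                              (subst (λ B → (a + 2 * (b + c)) * M + c + x ≡ n * M + B * (k + 4)) B≡1+k
                                     (deficit-equation a b c {x} {n} y+x≡nM))
                              x<M
        2k+1≤n : suc (k * 2) ≤ n
        2k+1≤n = s≤s⁻¹ (subst (_≤ suc n) (trans (cong (2 *_) B≡1+k) (double-suc k)) (subst (2 * (b + c) ≤_) q≡1+n (m≤n+m _ a)))
    in inj₂ (≤-antisym n≤2k+1 2k+1≤n , lo , hi)
    where
    double-suc : ∀ k → 2 * suc k ≡ suc (suc (k * 2))
    double-suc = solve-∀

  stairs-combination : ∀ {y x} n b → y + x ≡ n * M → 2 * b ≤ n → b * w ≤ x → x ≤ b * w + b → Combination y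
  stairs-combination {y} {x} n b y+x≡nM 2b≤n bw≤x x≤bw+b = a , i , b ∸ i , +-cancelʳ-≡ x _ y (begin
    a * M + i * G + (b ∸ i) * suc G + x                       ≡⟨ cong (a * M + i * G + (b ∸ i) * suc G +_) x≡ ⟨
    a * M + i * G + (b ∸ i) * suc G + ((i + (b ∸ i)) * w + i) ≡⟨ regroup a i (b ∸ i) M G k ⟩
    a * M + (i + (b ∸ i)) * (G + (k + 4))                     ≡⟨ cong (λ z → a * M + (i + (b ∸ i)) * z) G+[k+4]≡2M ⟩
    a * M + (i + (b ∸ i)) * (2 * M)                           ≡⟨ cong (λ z → a * M + z * (2 * M)) i+[b∸i]≡b ⟩
    a * M + b * (2 * M)                                       ≡⟨ collect a b M ⟩
    (2 * b + a) * M                                           ≡⟨ cong (_* M) (m+[n∸m]≡n 2b≤n) ⟩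
    n * M                                                     ≡⟨ y+x≡nM ⟨
    y + x                                                     ∎)
    where
    open ≡-Reasoning
    a = n ∸ 2 * b
    i = x ∸ b * w
    i≤b : i ≤ b
    i≤b = +-cancelˡ-≤ (b * w) i b (subst (_≤ b * w + b) (sym (m+[n∸m]≡n bw≤x)) x≤bw+b)
    i+[b∸i]≡b : i + (b ∸ i) ≡ b
    i+[b∸i]≡b = m+[n∸m]≡n i≤b
    x≡ : (i + (b ∸ i)) * w + i ≡ x
    x≡ = trans (cong (λ z → z * w + i) i+[b∸i]≡b) (m+[n∸m]≡n bw≤x)
    regroup : ∀ a i c M G k → a * M + i * G + c * suc G + ((i + c) * (k + 3) + i) ≡ a * M + (i + c) * (G + (k + 4))
    regroup = solve-∀
    collect : ∀ a b M → a * M + b * (2 * M) ≡ (2 * b + a) * M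
    collect = solve-∀

  top-combination : ∀ {y x} → y + x ≡ suc (k * 2) * M → 1 ≤ x → x ≤ k + 2 → Combination y
  top-combination {y} {suc e} y+x≡ _ 1+e≤k+2 = 0 , e , c , +-cancelʳ-≡ (suc e) _ y (begin
    e * G + c * suc G + suc e      ≡⟨ regroup e c G ⟩
    (e + c) * G + (e + c) + 1      ≡⟨ cong (λ z → z * G + z + 1) e+c≡k+1 ⟩
    (k + 1) * G + (k + 1) + 1      ≡⟨ shift k G ⟩
    (k + 1) * G + (k + 2)          ≡⟨ [k+1]G+[k+2]≡[2k+1]M ⟩
    suc (k * 2) * M                ≡⟨ y+x≡ ⟨
    y + suc e                      ∎)
    where
    open ≡-Reasoning
    c = k + 1 ∸ e
    e+c≡k+1 : e + c ≡ k + 1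
    e+c≡k+1 = m+[n∸m]≡n (s≤s⁻¹ (subst (suc e ≤_) (+-suc k 1) 1+e≤k+2))
    regroup : ∀ e c G → e * G + c * suc G + suc e ≡ (e + c) * G + (e + c) + 1
    regroup = solve-∀
    shift : ∀ k G → (k + 1) * G + (k + 1) + 1 ≡ (k + 1) * G + (k + 2)
    shift = solve-∀

  half-bound : ∀ {b B} → 2 * b ≤ 2 * B + 1 → b ≤ B
  half-bound {b} {B} 2b≤2B+1 with b ≤? B
  ... | yes b≤B = b≤B
  ... | no  b≰B = contradiction (≤-trans (*-monoʳ-≤ 2 (≰⇒> b≰B)) 2b≤2B+1) (<⇒≱ (subst (2 * B + 1 <_) (sym (identity B)) ≤-refl))
    where
    identity : ∀ B → 2 * suc B ≡ suc (2 * B + 1)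
    identity = solve-∀

  block-membership : ∀ {y x n B} → 2 * B ≤ n → n ≤ 2 * B + 1 → n ≤ k * 2 → y + x ≡ n * M → x < M →
                     T (C y) ⇔ T (stairs w B x)
  block-membership {y} {n = n} {B} 2B≤n n≤2B+1 n≤2k y+x≡nM x<M = mk⇔
    (λ cy → case combination-deficit (to T-C cy) y+x≡nM x<M (m≤n⇒m≤1+n n≤2k) of λ where
      (inj₁ (b , 2b≤n , on)) → from (T-stairs w B) (b , half-bound (≤-trans 2b≤n n≤2B+1) , on)
      (inj₂ (n≡2k+1 , _))    → contradiction (subst (_≤ k * 2) n≡2k+1 n≤2k) (<-irrefl refl))
    (λ s → let (b , b≤B , bw≤x , x≤bw+b) = to (T-stairs w B) s
           in from (T-C {y}) (stairs-combination n b y+x≡nM (≤-trans (*-monoʳ-≤ 2 b≤B) 2B≤n) bw≤x x≤bw+b))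

  top-block-membership : ∀ {y x} → y + x ≡ suc (k * 2) * M → x < M →
                         T (C y) ⇔ T (stairs w k x ∨ within 1 (1 + (k + 2)) x)
  top-block-membership {y} {x} y+x≡ x<M = mk⇔
    (λ cy → case combination-deficit (to T-C cy) y+x≡ x<M ≤-refl of λ where
      (inj₁ (b , 2b≤ , on))   → from T-∨ (inj₁ (from (T-stairs w k) (b , half-bound (subst (2 * b ≤_) (2k+1≡ k) 2b≤) , on)))
      (inj₂ (_ , 1≤x , x≤))   → from T-∨ (inj₂ (from (T-within 1 (1 + (k + 2))) (1≤x , s≤s x≤))))
    (λ s → case to T-∨ s of λ where
      (inj₁ s′) → let (b , b≤k , bw≤x , x≤bw+b) = to (T-stairs w k) s′
                  in from (T-C {y}) (stairs-combination (suc (k * 2)) b y+x≡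
                                       (≤-trans (*-monoʳ-≤ 2 b≤k) (subst (2 * k ≤_) (sym (2k+1≡ k)) (m≤m+n _ 1)))
                                       bw≤x x≤bw+b)
      (inj₂ s′) → let (1≤x , x<) = to (T-within 1 (1 + (k + 2))) s′
                  in from (T-C {y}) (top-combination y+x≡ 1≤x (s≤s⁻¹ x<)))
    where
    2k+1≡ : ∀ k → suc (k * 2) ≡ 2 * k + 1
    2k+1≡ = solve-∀

  block-offsets : ∀ {n i j} → suc (i + j) ≡ M → n * M + 1 + i + j ≡ suc n * M
  block-offsets {n} {i} {j} e = trans (identity (n * M) i j) (trans (cong (n * M +_) e) (+-comm (n * M) M))
    where
    identity : ∀ y i j → y + 1 + i + j ≡ y + suc (i + j)
    identity = solve-∀

  -- Block n + 1 is [nμ + 1, (n + 1)μ]; reading it backwards turns each element into its deficit.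
  block-count : ∀ n B → 2 * B ≤ suc n → suc n ≤ 2 * B + 1 → suc n ≤ k * 2 → count C (n * M + 1) M ≡ stairsSize B
  block-count n B 2B≤ ≤2B+1 ≤2k = begin
    count C (n * M + 1) M     ≡⟨ count-reflect {C} {stairs w B} (n * M + 1) 0 M (λ i j e →
                                   block-membership {n * M + 1 + i} {j} {suc n} {B} 2B≤ ≤2B+1 ≤2k
                                                    (block-offsets {n} e) (subst (j <_) e (s≤s (m≤n+m j i)))) ⟩
    count (stairs w B) 0 M    ≡⟨ count-stairs w B M (≤-<-trans B≤k (m<m+n k z<s)) (stairs-below-M B≤k) ⟩
    stairsSize B              ∎
    where
    open ≡-Reasoning
    B≤k : B ≤ k
    B≤k = *-cancelˡ-≤ 2 (≤-trans 2B≤ (subst (suc n ≤_) (*-comm k 2) ≤2k))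

  top-block-count : count C (t + 1) M ≡ stairsSize k + (k + 2)
  top-block-count = begin
    count C (t + 1) M                                               ≡⟨ count-reflect {C} {Top} (t + 1) 0 M (λ i j e →
                                                                         top-block-membership {t + 1 + i} {j} (block-offsets {k * 2} e)
                                                                                              (subst (j <_) e (s≤s (m≤n+m j i)))) ⟩
    count Top 0 M                                                   ≡⟨ count-∨ disjoint 0 M ⟩
    count (stairs w k) 0 M + count (within 1 (1 + (k + 2))) 0 M     ≡⟨ cong₂ _+_ (count-stairs w k M (m<m+n k z<s) (stairs-below-M ≤-refl))
                                                                                 (count-within 0 M 1 (k + 2) z≤n k+2<M) ⟩
    stairsSize k + (k + 2)                                          ∎
    where
    open ≡-Reasoning
    Top : ℕ → Bool
    Top x = stairs w k x ∨ within 1 (1 + (k + 2)) x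
    disjoint : ∀ x → T (stairs w k x) → ¬ T (within 1 (1 + (k + 2)) x)
    disjoint x s i with to (T-stairs w k) s | to (T-within 1 (1 + (k + 2))) i
    ... | zero  , _ , _    , x≤0 | 1≤x , _   = <⇒≱ 1≤x x≤0
    ... | suc b , _ , bw≤x , _   | _   , x<  = <⇒≱ (subst (x <_) (sym (+-suc k 2)) x<) (≤-trans (m≤m+n w (b * w)) bw≤x)

  blockSum : ℕ → ℕ
  blockSum zero    = 0
  blockSum (suc K) = blockSum K + stairsSize K + stairsSize (suc K)

  blockSum-closed : ∀ K → 6 * (blockSum K + 1) ≡ (K + 1) * (K + 2) * (2 * K + 3)
  blockSum-closed zero    = refl
  blockSum-closed (suc K) = begin
    6 * (blockSum K + stairsSize K + stairsSize (suc K) + 1)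
      ≡⟨ regroup (blockSum K) (stairsSize K) (stairsSize (suc K)) ⟩
    6 * (blockSum K + 1) + 3 * (2 * stairsSize K) + 3 * (2 * stairsSize (suc K))
      ≡⟨ cong₂ (λ u v → u + 3 * v + 3 * (2 * stairsSize (suc K))) (blockSum-closed K) (stairsSize-closed K) ⟩
    (K + 1) * (K + 2) * (2 * K + 3) + 3 * ((K + 1) * (K + 2)) + 3 * (2 * stairsSize (suc K))
      ≡⟨ cong (λ v → (K + 1) * (K + 2) * (2 * K + 3) + 3 * ((K + 1) * (K + 2)) + 3 * v) (stairsSize-closed (suc K)) ⟩
    (K + 1) * (K + 2) * (2 * K + 3) + 3 * ((K + 1) * (K + 2)) + 3 * ((suc K + 1) * (suc K + 2))
      ≡⟨ identity K ⟩
    (suc K + 1) * (suc K + 2) * (2 * suc K + 3) ∎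
    where
    open ≡-Reasoning
    regroup : ∀ F S S′ → 6 * (F + S + S′ + 1) ≡ 6 * (F + 1) + 3 * (2 * S) + 3 * (2 * S′)
    regroup = solve-∀
    identity : ∀ K → (K + 1) * (K + 2) * (2 * K + 3) + 3 * ((K + 1) * (K + 2)) + 3 * ((suc K + 1) * (suc K + 2))
                   ≡ (suc K + 1) * (suc K + 2) * (2 * suc K + 3)
    identity = solve-∀

  count-first-blocks : ∀ K → K ≤ k → count C 1 (K * 2 * M) ≡ blockSum K
  count-first-blocks zero    _     = refl
  count-first-blocks (suc K) 1+K≤k = begin
    count C 1 (suc K * 2 * M)                                           ≡⟨ cong (count C 1) (split K M) ⟩
    count C 1 (K * 2 * M + (M + M))                                     ≡⟨ count-++ C 1 (K * 2 * M) (M + M) ⟩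
    count C 1 (K * 2 * M) + count C (1 + K * 2 * M) (M + M)             ≡⟨ cong (count C 1 (K * 2 * M) +_) (count-++ C (1 + K * 2 * M) M M) ⟩
    count C 1 (K * 2 * M) + (count C (1 + K * 2 * M) M + count C (1 + K * 2 * M + M) M)
      ≡⟨ cong₂ (λ u v → count C 1 (K * 2 * M) + (count C u M + count C v M)) (+-comm 1 (K * 2 * M)) (shift (K * 2 * M) M) ⟩
    count C 1 (K * 2 * M) + (count C (K * 2 * M + 1) M + count C (suc (K * 2) * M + 1) M)
      ≡⟨ cong₂ (λ u v → count C 1 (K * 2 * M) + (u + v))
               (block-count (K * 2) K (≤-trans (≤-reflexive (*-comm 2 K)) (n≤1+n _)) (≤-reflexive (odd K))
                            (≤-trans (n≤1+n _) 2K+2≤2k))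
               (block-count (suc (K * 2)) (suc K) (≤-reflexive (double-suc K))
                            (≤-trans (≤-reflexive (sym (double-suc K))) (m≤m+n _ 1)) 2K+2≤2k) ⟩
    count C 1 (K * 2 * M) + (stairsSize K + stairsSize (suc K))         ≡⟨ cong (_+ _) (count-first-blocks K (<⇒≤ 1+K≤k)) ⟩
    blockSum K + (stairsSize K + stairsSize (suc K))                    ≡⟨ +-assoc (blockSum K) _ _ ⟨
    blockSum (suc K)                                                    ∎
    where
    open ≡-Reasoning
    2K+2≤2k : suc (suc (K * 2)) ≤ k * 2
    2K+2≤2k = *-monoˡ-≤ 2 1+K≤k
    split : ∀ K M → suc K * 2 * M ≡ K * 2 * M + (M + M)
    split = solve-∀
    shift : ∀ y M → 1 + y + M ≡ M + y + 1
    shift = solve-∀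
    odd : ∀ K → suc (K * 2) ≡ 2 * K + 1
    odd = solve-∀
    double-suc : ∀ K → 2 * suc K ≡ suc (suc (K * 2))
    double-suc = solve-∀

  mem⇔Combination : ∀ {y} → y < t → T (S.mem y) ⇔ Combination y
  mem⇔Combination y<t = ⇔.trans (mem-< gens t y<t) T-C

  M<t : M < t
  M<t = <-≤-trans (subst (M <_) (cong (M +_) (sym (+-identityʳ M))) (m<m+n M z<s)) 2M≤t

  member-≥M : ∀ {y} → 0 < y → y < t → T (S.mem y) → M ≤ y
  member-≥M 0<y y<t my = combination-≥M (to (mem⇔Combination y<t) my) 0<y

  SumOfTwo⇒Decomposable : ∀ {s} → SumOfTwo s → Decomposable gens t s
  SumOfTwo⇒Decomposable (g , r , 0<g , 0<r , g+r≡s , cg , cr) =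
    g , r , 0<g , 0<r , g+r≡s , combo⇒mem gens t {g} (from T-C cg) , combo⇒mem gens t {r} (from T-C cr)

  Decomposable⇒SumOfTwo : ∀ {s} → Decomposable gens t s → s < t + M → SumOfTwo s
  Decomposable⇒SumOfTwo (a , r , 0<a , 0<r , refl , ma , mr) a+r<t+M =
    a , r , 0<a , 0<r , refl , to (mem⇔Combination a<t) ma , to (mem⇔Combination r<t) mr
    where
    other-below-t : ∀ {u v} → 0 < v → T (S.mem v) → u + v < t + M → u < t
    other-below-t {u} {v} 0<v mv u+v<t+M with u <? t
    ... | yes u<t = u<t
    ... | no  u≮t = contradiction (member-≥M 0<v (<-trans v<M M<t) mv) (<⇒≱ v<M)
      where
      v<M : v < M
      v<M = +-cancelˡ-< t v M (≤-<-trans (+-monoˡ-≤ v (≮⇒≥ u≮t)) u+v<t+M)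
    a<t : a < t
    a<t = other-below-t 0<r mr a+r<t+M
    r<t : r < t
    r<t = other-below-t 0<a ma (subst (_< t + M) (+-comm a r) a+r<t+M)

  conductor≡t : S.conductor ≡ t
  conductor≡t = conductor-≡ gens t λ m →
    not-on-stairs (to (block-membership {pred t} {1} {k * 2} {k} (≤-reflexive (*-comm 2 k)) (≤-trans (≤-reflexive (*-comm k 2)) (m≤m+n _ 1))
                        ≤-refl (trans (+-comm (pred t) 1) (suc-pred t)) (s≤s (s≤s z≤n)))
                      (to (mem-< gens t (m≤pred[n]⇒suc[m]≤n ≤-refl)) m))
    where
    not-on-stairs : ¬ T (stairs w k 1)
    not-on-stairs s with to (T-stairs w k) s
    ... | zero  , _ , _    , 1≤0 = <⇒≱ z<s 1≤0
    ... | suc b , _ , bw≤1 , _   = <⇒≱ (≤-trans (s≤s (s≤s z≤n)) (m≤n+m 3 k)) (≤-trans (m≤m+n w (b * w)) bw≤1)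

  multiplicity≡M : S.multiplicity ≡ M
  multiplicity≡M = multiplicity-≡ gens t M z<s (<⇒≤ M<t) (from (mem⇔Combination M<t) combination-M)
                     (λ y 0<y y<M my → <⇒≱ y<M (member-≥M 0<y (<-trans y<M M<t) my))

  combination-t : Combination t
  combination-t = combination-M* (k * 2)

  combination-t+M : Combination (t + M)
  combination-t+M = subst Combination (+-comm M t) (combination-M* (suc (k * 2)))

  length-L≡ : length S.L ≡ blockSum k
  length-L≡ = begin
    length S.L                 ≡⟨ length-L gens t ⟩
    count S.mem 0 S.conductor  ≡⟨ cong (count S.mem 0) conductor≡t ⟩
    count S.mem 0 t            ≡⟨ count-cong 0 t (λ y _ y<t → mem-< gens t y<t) ⟩
    count C 0 t                ≡⟨ count-step C 0 t (mk⇔ (λ _ → from T-C combination-t) (λ _ → from (T-C {0}) (0 , 0 , 0 , refl))) ⟩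
    count C 1 t                ≡⟨ count-first-blocks k ≤-refl ⟩
    blockSum k                 ∎
    where open ≡-Reasoning

  2+G≤2M : 2 + G ≤ 2 * M
  2+G≤2M = subst (2 + G ≤_) G+[k+4]≡2M (subst (_≤ G + (k + 4)) (+-comm G 2) (+-monoʳ-≤ G (≤-trans (s≤s (s≤s z≤n)) (m≤n+m 4 k))))

  generator-bounds : ∀ {s} → IsGenerator s → M ≤ s × s < 2 * M
  generator-bounds (inj₁ refl)        = ≤-refl , subst (M <_) (cong (M +_) (sym (+-identityʳ M))) (m<m+n M z<s)
  generator-bounds (inj₂ (inj₁ refl)) = <⇒≤ M<G , ≤-trans (n≤1+n _) 2+G≤2M
  generator-bounds (inj₂ (inj₂ refl)) = ≤-trans (<⇒≤ M<G) (n≤1+n G) , 2+G≤2M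

  generator-combination : ∀ {s} → IsGenerator s → Combination s
  generator-combination (inj₁ refl)        = combination-M
  generator-combination (inj₂ (inj₁ refl)) = combination-G
  generator-combination (inj₂ (inj₂ refl)) = combination-suc-G

  Generator : ℕ → Bool
  Generator s = within M (M + 1) s ∨ within G (G + 2) s

  IsGenerator⇔ : ∀ {s} → IsGenerator s ⇔ T (Generator s)
  IsGenerator⇔ {s} = mk⇔ to′ from′
    where
    to′ : IsGenerator s → T (Generator s)
    to′ (inj₁ refl)        = from T-∨ (inj₁ (from (T-within M (M + 1)) (≤-refl , subst (M <_) (+-comm 1 M) ≤-refl)))
    to′ (inj₂ (inj₁ refl)) = from T-∨ (inj₂ (from (T-within G (G + 2)) (≤-refl , subst (G <_) (+-comm 2 G) (n≤1+n _))))
    to′ (inj₂ (inj₂ refl)) = from T-∨ (inj₂ (from (T-within G (G + 2)) (n≤1+n G , subst (suc G <_) (+-comm 2 G) ≤-refl)))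
    from′ : T (Generator s) → IsGenerator s
    from′ gen with to T-∨ gen
    ... | inj₁ m with M≤s , s< ← to (T-within M (M + 1)) m =
      inj₁ (≤-antisym (s≤s⁻¹ (subst (s <_) (+-comm M 1) s<)) M≤s)
    ... | inj₂ g with G≤s , s< ← to (T-within G (G + 2)) g | m≤n⇒m<n∨m≡n G≤s
    ...   | inj₂ G≡s = inj₂ (inj₁ (sym G≡s))
    ...   | inj₁ G<s = inj₂ (inj₂ (≤-antisym (s≤s⁻¹ (subst (s <_) (+-comm G 2) s<)) G<s))

  primitive⇔generator : ∀ {s} → s < t → T (S.mem s ∧ S.isPrimitive s) ⇔ T (Generator s)
  primitive⇔generator {s} s<t = mk⇔ to′ from′
    where
    to′ : T (S.mem s ∧ S.isPrimitive s) → T (Generator s)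
    to′ mp with ms , prim ← to T-∧ mp with _ , 0<s , indecomposable ← to (T-isPrimitive gens t s) prim =
      decidable-stable (T? (Generator s)) λ ¬gen →
        indecomposable (SumOfTwo⇒Decomposable (Combination⇒SumOfTwo (to (mem⇔Combination s<t) ms) 0<s (¬gen ∘ to IsGenerator⇔)))
    from′ : T (Generator s) → T (S.mem s ∧ S.isPrimitive s)
    from′ gen = from T-∧ (ms , from (T-isPrimitive gens t s) (ms , <-≤-trans z<s M≤s , indecomposable))
      where
      isGen = from IsGenerator⇔ gen
      M≤s = proj₁ (generator-bounds isGen)
      ms = from (mem⇔Combination s<t) (generator-combination isGen)
      indecomposable : ¬ Decomposable gens t s
      indecomposable d = <⇒≱ (proj₂ (generator-bounds isGen)) (SumOfTwo⇒2M≤ (Decomposable⇒SumOfTwo d (<-≤-trans s<t (m≤m+n t M))))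

  length-PL≡3 : length S.PL ≡ 3
  length-PL≡3 = begin
    length S.PL                                                 ≡⟨ length-PL gens t ⟩
    count (λ s → S.mem s ∧ S.isPrimitive s) 0 S.conductor       ≡⟨ cong (count _ 0) conductor≡t ⟩
    count (λ s → S.mem s ∧ S.isPrimitive s) 0 t                 ≡⟨ count-cong 0 t (λ s _ s<t → primitive⇔generator s<t) ⟩
    count Generator 0 t                                         ≡⟨ count-∨ M-below-G 0 t ⟩
    count (within M (M + 1)) 0 t + count (within G (G + 2)) 0 t ≡⟨ cong₂ _+_ (count-within 0 t M 1 z≤n (subst (_≤ t) (+-comm 1 M) M<t))
                                                                             (count-within 0 t G 2 z≤n
                                                                               (subst (_≤ t) (+-comm 2 G) (≤-trans 2+G≤2M 2M≤t))) ⟩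
    3                                                           ∎
    where
    open ≡-Reasoning
    M-below-G : ∀ s → T (within M (M + 1) s) → ¬ T (within G (G + 2) s)
    M-below-G s m g = <⇒≱ (subst (s <_) (+-comm M 1) (proj₂ (to (T-within M (M + 1)) m))) (≤-trans M<G (proj₁ (to (T-within G (G + 2)) g)))

  nonprimitive⇔combination : ∀ {z} → t ≤ z → z < t + M → T (not (S.isPrimitive z)) ⇔ T (C z)
  nonprimitive⇔combination {z} t≤z z<t+M = mk⇔
    (λ np → from T-C (SumOfTwo⇒Combination (Decomposable⇒SumOfTwo
              (¬isPrimitive⇒Decomposable gens t z (mem-≥ gens t t≤z) 0<z (to (T-not _) np)) z<t+M)))
    (λ cz → from (T-not _) λ prim → proj₂ (proj₂ (to (T-isPrimitive gens t z) prim))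
              (SumOfTwo⇒Decomposable (Combination⇒SumOfTwo (to T-C cz) 0<z λ gen →
                <⇒≱ (<-≤-trans (proj₂ (generator-bounds gen)) 2M≤t) t≤z)))
    where
    0<z : 0 < z
    0<z = <-≤-trans (<-trans z<s M<t) t≤z

  length-Dq≡ : length S.Dq ≡ stairsSize k + (k + 2)
  length-Dq≡ = begin
    length S.Dq                                                   ≡⟨ length-Dq gens t ⟩
    count (not ∘ S.isPrimitive) S.conductor S.multiplicity        ≡⟨ cong₂ (count _) conductor≡t multiplicity≡M ⟩
    count (not ∘ S.isPrimitive) t M                               ≡⟨ count-cong t M (λ _ → nonprimitive⇔combination) ⟩
    count C t M                                                   ≡⟨ count-step C t M (mk⇔ (λ _ → from T-C combination-t+M)
                                                                                          (λ _ → from T-C combination-t)) ⟩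
    count C (suc t) M                                             ≡⟨ cong (λ a → count C a M) (+-comm 1 t) ⟩
    count C (t + 1) M                                             ≡⟨ top-block-count ⟩
    stairsSize k + (k + 2)                                        ∎
    where open ≡-Reasoning

  q≡2k : S.q ≡ k * 2
  q≡2k = trans (cong₂ S.ceilDiv conductor≡t multiplicity≡M) (ceilDiv-* gens t (k * 2) (suc (k * (k + 4))))

  ρ≡0 : S.ρ ≡ 0
  ρ≡0 = trans (cong₂ (λ q c → q * S.multiplicity ∸ c) q≡2k conductor≡t)
              (trans (cong (λ m → k * 2 * m ∸ t) multiplicity≡M) (n∸n≡0 t))

  eliahou-identity : 8 * (3 * blockSum k) + k * 2 * (k * 2) ≡ 8 * (k * 2 * (stairsSize k + (k + 2))) + 2 * (k * 2)
  eliahou-identity = +-cancelʳ-≡ 24 _ _ (begin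
    8 * (3 * blockSum k) + k * 2 * (k * 2) + 24                     ≡⟨ expand-left (blockSum k) k ⟩
    4 * (6 * (blockSum k + 1)) + k * 2 * (k * 2)                    ≡⟨ cong (λ z → 4 * z + k * 2 * (k * 2)) (blockSum-closed k) ⟩
    4 * ((k + 1) * (k + 2) * (2 * k + 3)) + k * 2 * (k * 2)         ≡⟨ polynomial k ⟩
    8 * k * ((k + 1) * (k + 2)) + 16 * k * (k + 2) + 4 * k + 24     ≡⟨ cong (λ z → 8 * k * z + 16 * k * (k + 2) + 4 * k + 24) (stairsSize-closed k) ⟨
    8 * k * (2 * stairsSize k) + 16 * k * (k + 2) + 4 * k + 24      ≡⟨ expand-right (stairsSize k) k ⟨
    8 * (k * 2 * (stairsSize k + (k + 2))) + 2 * (k * 2) + 24       ∎)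
    where
    open ≡-Reasoning
    expand-left : ∀ F k → 8 * (3 * F) + k * 2 * (k * 2) + 24 ≡ 4 * (6 * (F + 1)) + k * 2 * (k * 2)
    expand-left = solve-∀
    polynomial : ∀ k → 4 * ((k + 1) * (k + 2) * (2 * k + 3)) + k * 2 * (k * 2)
                     ≡ 8 * k * ((k + 1) * (k + 2)) + 16 * k * (k + 2) + 4 * k + 24
    polynomial = solve-∀
    expand-right : ∀ S k → 8 * (k * 2 * (S + (k + 2))) + 2 * (k * 2) + 24 ≡ 8 * k * (2 * S) + 16 * k * (k + 2) + 4 * k + 24
    expand-right = solve-∀

  μ≡M : μ (k * 2) ≡ M
  μ≡M = trans (cong (λ h → h * h + 2 * (k * 2) + 2) (m*n/n≡m k 2)) (identity k)
    where
    identity : ∀ k → k * k + 2 * (k * 2) + 2 ≡ 2 + k * (k + 4)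
    identity = solve-∀

  γ≡G : γ (k * 2) ≡ G
  γ≡G = trans (cong₂ (λ m h → 2 * m ∸ (h + 4)) μ≡M (m*n/n≡m k 2))
              (trans (cong (_∸ (k + 4)) (sym G+[k+4]≡2M)) (m+n∸n≡m G (k + 4)))

  E-S≡eliahou : E-S (k * 2) ≡ S.eliahou
  E-S≡eliahou = cong₂ (λ m g → Semigroup.eliahou (m ∷ g ∷ suc g ∷ []) (k * 2 * m)) μ≡M γ≡G

open import Defs
open import Data.Nat as ℕ using (ℕ; _<_; zero; suc)
open import Data.Nat.Divisibility using (_∣_; divides)
open import Data.Integer using (+_; _+_; _*_; _-_)
open import Data.Integer.Properties using (pos-+; pos-*)
open import Data.Integer.Tactic.RingSolver using (solve-∀)
open import Data.List using (length)
open import Relation.Binary.PropositionalEquality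

difference-identity : ∀ A B c → 8 ℕ.* A ℕ.+ c ℕ.* c ≡ 8 ℕ.* B ℕ.+ 2 ℕ.* c →
                      + 8 * (+ A - + B + + 0) ≡ + c * (+ 2 - + c)
difference-identity A B c eq = begin
  + 8 * (+ A - + B + + 0)                            ≡⟨ spread (+ A) (+ B) (+ c) ⟩
  (+ 8 * + A + + c * + c) - (+ 8 * + B + + c * + c)  ≡⟨ cong (_- (+ 8 * + B + + c * + c)) (trans (sym (cast 8 A c c)) (cong +_ eq)) ⟩
  + (8 ℕ.* B ℕ.+ 2 ℕ.* c) - (+ 8 * + B + + c * + c)  ≡⟨ cong (_- (+ 8 * + B + + c * + c)) (cast 8 B 2 c) ⟩
  (+ 8 * + B + + 2 * + c) - (+ 8 * + B + + c * + c)  ≡⟨ collapse (+ B) (+ c) ⟩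
  + c * (+ 2 - + c)                                  ∎
  where
  open ≡-Reasoning
  spread : ∀ A B c → + 8 * (A - B + + 0) ≡ (+ 8 * A + c * c) - (+ 8 * B + c * c)
  spread = solve-∀
  collapse : ∀ B c → (+ 8 * B + + 2 * c) - (+ 8 * B + c * c) ≡ c * (+ 2 - c)
  collapse = solve-∀
  cast : ∀ a b c d → + (a ℕ.* b ℕ.+ c ℕ.* d) ≡ + a * + b + + c * + d
  cast a b c d = trans (pos-+ (a ℕ.* b) (c ℕ.* d)) (cong₂ _+_ (pos-* a b) (pos-* c d))

theorem3p20 : (p : ℕ) → 0 < p → 2 ∣ p →
    + 8 * E-S p ≡ + p * (+ 2 - + p)
theorem3p20 _ ()  (divides zero refl)
theorem3p20 _ _   (divides (suc j) refl) = begin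
    + 8 * E-S (k ℕ.* 2)
  ≡⟨ cong (+ 8 *_) E-S≡eliahou ⟩
    + 8 * (+ (length S.PL ℕ.* length S.L) - + (S.q ℕ.* length S.Dq) + + S.ρ)
  ≡⟨ cong (+ 8 *_) (cong₂ _+_ (cong₂ (λ a b → + a - + b) (cong₂ ℕ._*_ length-PL≡3 length-L≡)
                                                         (cong₂ ℕ._*_ q≡2k length-Dq≡))
                              (cong +_ ρ≡0)) ⟩
    + 8 * (+ (3 ℕ.* blockSum k) - + (k ℕ.* 2 ℕ.* (stairsSize k ℕ.+ (k ℕ.+ 2))) + + 0)
  ≡⟨ difference-identity (3 ℕ.* blockSum k) (k ℕ.* 2 ℕ.* (stairsSize k ℕ.+ (k ℕ.+ 2))) (k ℕ.* 2)
                         eliahou-identity ⟩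
    + (k ℕ.* 2) * (+ 2 - + (k ℕ.* 2))
  ∎
  where
  open ≡-Reasoning
  open EvenCase j
  open Segments using (stairsSize)
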